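{- Let $m\ge 1$ and $n\ge 0$ be integers. The Doob graph $D(m,n)$ can be obtained from the Hamming graph $H(2m+n,4)$ by Godsil--McKay switching $m$ times; that is, there exist graphs $\Gamma_0=H(2m+n,4),\Gamma_1,\dots,\Gamma_m$ such that for each $k\in[m]$, $\Gamma_k$ is isomorphic to $\mathrm{sw}_{\pi_k}\Gamma_{k-1}$ for some Godsil--McKay partition $\pi_k$ of $\Gamma_{k-1}$, and $\Gamma_m\cong D(m,n)$.
   Context: A partition $\{C_1,\dots,C_t\}$ of a vertex set is equitable if for all $i,j$ any two vertices of $C_i$ have the same number of neighbours in $C_j$. A partition $\pi=\{C_1,\dots,C_t,D\}$ of $V(\Gamma)$ is a Godsil--McKay partition with Godsil--McKay cell $D$ if (i) $\{C_1,\dots,C_t\}$ is an equitable partition of the induced subgraph on $V(\Gamma)\setminus D$, and (ii) every $x\in D$ has $0$, $\tfrac12|C_i|$ or $|C_i|$ neighbours in each $C_i$. The switched graph $\mathrm{sw}_\pi\Gamma$ is obtained from $\Gamma$ by interchanging adjacency and nonadjacency between $x\in D$ and the vertices of $C_i$ whenever $x$ has exactly $\tfrac12|C_i|$ neighbours in $C_i$. The Cartesian product $\Gamma\,\square\,\Delta$ has vertex set $V(\Gamma)\times V(\Delta)$, with $(x,w)\sim(x',w')$ iff ($x\sim x'$ and $w=w'$) or ($x=x'$ and $w\sim w'$). The Hamming graph $H(d,q)$ is the Cartesian product of $d$ copies of the complete graph $K_q$. Writing $V(H(2,4))=[4]\times[4]$ and $C=\{(x,x)\mid x\in[4]\}$,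 the partition $\{C,V(H(2,4))\setminus C\}$ is a Godsil--McKay partition with Godsil--McKay cell $V(H(2,4))\setminus C$; the resulting switched graph is the Shrikhande graph $Sh$. The Doob graph $D(m,n)$ is the Cartesian product of $m$ copies of $Sh$ and $n$ copies of $K_4$. -}

module Defs where

open import Data.Nat using (ℕ; zero; suc; _+_; _*_; _^_; _≡ᵇ_)
open import Data.Bool using (Bool; true; false; not; _∧_; _∨_; if_then_else_)
open import Data.Fin as F using (Fin; zero; suc; remQuot)
open import Data.Maybe using (Maybe; just; nothing)
open import Data.Product using (Σ; ∃; _×_; _,_; proj₁; proj₂)
open import Data.Sum using (_⊎_)
open import Function.Bundles using (_↔_; Inverse)
open import Relation.Binary.PropositionalEquality using (_≡_)
open import Relation.Nullary.Decidable using (⌊_⌋)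

-- A (finite) graph on the vertex set Fin N, given by its Boolean adjacency
-- relation.  (All graphs constructed here are simple; the existentially
-- quantified graphs are forced to be isomorphic to simple graphs.)
Graph : ℕ → Set
Graph N = Fin N → Fin N → Bool

_==_ : ∀ {N} → Fin N → Fin N → Bool
x == y = ⌊ x F.≟ y ⌋

count : ∀ {N} → (Fin N → Bool) → ℕ
count {zero}  p = 0
count {suc N} p = (if p zero then 1 else 0) + count (λ v → p (suc v))

_≅_ : ∀ {N M} → Graph N → Graph M → Set
_≅_ {N} {M} G H =
  Σ (Fin N ↔ Fin M) λ f →
    ∀ x y → H (Inverse.to f x) (Inverse.to f y) ≡ G x y

K : (q : ℕ) → Graph q
K q x y = not (x == y)

_□_ : ∀ {a b} → Graph a → Graph b → Graph (a * b)
_□_ {a} {b} G H u v with remQuot {a} b u | remQuot {a} b v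
... | (x , w) | (x' , w') = (G x x' ∧ (w == w')) ∨ ((x == x') ∧ H w w')

Hamming4 : (d : ℕ) → Graph (4 ^ d)
Hamming4 zero    = K 1
Hamming4 (suc d) = K 4 □ Hamming4 d

-- A partition {C_1,...,C_t, D} of Fin N, given by a labelling:
-- label v ≡ just i means v ∈ C_i, label v ≡ nothing means v ∈ D.
-- All cells are required to be nonempty.
record Partition (N t : ℕ) : Set where
  field
    label    : Fin N → Maybe (Fin t)
    C-nonempty : ∀ (i : Fin t) → ∃ λ v → label v ≡ just i
    D-nonempty : ∃ λ v → label v ≡ nothing
open Partition public

inCell : ∀ {N t} → Partition N t → Fin t → Fin N → Bool
inCell π i v with label π v
... | just j  = j == i
... | nothing = false

cellSize : ∀ {N t} → Partition N t → Fin t → ℕ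
cellSize π i = count (inCell π i)

nbrsIn : ∀ {N t} → Graph N → Partition N t → Fin N → Fin t → ℕ
nbrsIn G π x i = count (λ v → inCell π i v ∧ G x v)

record IsGodsilMcKay {N t : ℕ} (G : Graph N) (π : Partition N t) : Set where
  field
    equitable : ∀ (i j : Fin t) (u v : Fin N) →
      label π u ≡ just i → label π v ≡ just i →
      nbrsIn G π u j ≡ nbrsIn G π v j
    D-condition : ∀ (x : Fin N) → label π x ≡ nothing → ∀ (i : Fin t) →
      (nbrsIn G π x i ≡ 0) ⊎ (2 * nbrsIn G π x i ≡ cellSize π i)
        ⊎ (nbrsIn G π x i ≡ cellSize π i)

flips : ∀ {N t} → Graph N → Partition N t → Fin N → Fin N → Bool
flips G π x y with label π x | label π y
... | nothing | just i = (2 * nbrsIn G π x i) ≡ᵇ cellSize π i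
... | _       | _      = false

sw : ∀ {N t} → Partition N t → Graph N → Graph N
sw π G x y =
  if flips G π x y ∨ flips G π y x then not (G x y) else G x y

-- Shrikhande graph: switching of H(2,4) w.r.t. {C, V \ C},
-- C = diagonal {(x,x)}.
diagLabel : Fin (4 ^ 2) → Maybe (Fin 1)
diagLabel v with remQuot {4} (4 ^ 1) v
... | (x , r) with remQuot {4} 1 r
...   | (y , _) = if x == y then just zero else nothing

diagPartition : Partition (4 ^ 2) 1
diagPartition = record
  { label = diagLabel
  ; C-nonempty = λ { zero → zero , _≡_.refl }
  ; D-nonempty = suc zero , _≡_.refl
  }

Shrikhande : Graph (4 ^ 2)
Shrikhande = sw diagPartition (Hamming4 2)

ShPow : (m : ℕ) → Graph (16 ^ m)
ShPow zero    = K 1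
ShPow (suc m) = Shrikhande □ ShPow m

Doob : (m n : ℕ) → Graph (16 ^ m * 4 ^ n)
Doob m n = ShPow m □ Hamming4 n

-- Godsil–McKay switching is compatible with graph isomorphism and with the
-- Cartesian product by a loopless nonempty factor P: a Godsil–McKay partition
-- {C₁, …, C_t, D} of G lifts to the partition of P □ G with cells {u} × C_i and
-- Godsil–McKay cell V(P) × D, and switching P □ G along it gives P □ sw G.
-- Since H(2,4) switches to the Shrikhande graph, peeling two K₄ factors off
-- H(2(m − j) + n, 4) at a time turns Sh^j □ H(2(m − j) + n, 4) into
-- Sh^(j+1) □ H(2(m − j − 1) + n, 4), and after m switchings we reach D(m, n).
module Submission where

open import Defs
open import Data.Nat using (ℕ) renaming (suc to 1+)
open import Data.Nat using (_+_; _*_; _^_; _≤_)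
open import Data.Fin using (Fin; zero; suc; inject₁; fromℕ)
open import Data.Product using (Σ; ∃; _×_; _,_)
open import Relation.Binary.PropositionalEquality using (_≡_)

open import Data.Bool using (Bool; true; false; not; _∧_; _∨_; if_then_else_)
open import Data.Bool.Properties
  using (∧-assoc; ∧-comm; ∧-identityʳ; ∧-zeroʳ; ∨-comm; ∨-identityʳ; ∨-∧-commutativeSemiring)
  renaming (_≟_ to _≟ᵇ_)
open import Data.Fin using (toℕ; cast; combine; remQuot; _↑ˡ_; _↑ʳ_; punchIn)
open import Data.Fin.Properties
  using (all?; *↔×; remQuot-combine; combine-remQuot; combine-injective; cast-involutive;
         punchInᵢ≢i; toℕ-inject₁; toℕ-fromℕ; toℕ<n)
  renaming (_≟_ to _≟ᶠ_)
open import Data.Maybe using (Maybe; just; nothing; map)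
open import Data.Maybe.Properties using (just-injective) renaming (≡-dec to ≡-decᵐ)
open import Data.Nat using (zero; _∸_; _≡ᵇ_)
open import Data.Nat.Properties
  using (+-assoc; +-identityʳ; +-suc; +-∸-assoc; *-suc; *-distribˡ-+; n∸n≡0; m+[n∸m]≡n;
         ^-distribˡ-+-*; ^-*-assoc; ≤-pred; +-0-commutativeMonoid)
  renaming (_≟_ to _≟ⁿ_)
open import Algebra.Properties.CommutativeMonoid.Sum +-0-commutativeMonoid
  using (sum; sum-cong-≗; sum-remove; sum-replicate-zero; sum-permute)
open import Data.Product using (proj₁; proj₂; uncurry)
open import Data.Product.Algebra using (×-comm; ×-assoc)
open import Data.Product.Function.NonDependent.Propositional using (_×-↔_)
open import Data.Sum using (_⊎_; inj₁; inj₂)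
open import Function using (_∘_)
open import Function.Bundles using (_↔_; Inverse; Injection; mk↔ₛ′)
open import Function.Properties.Inverse using (↔-refl; ↔-sym; ↔-trans; ↔⇒↣)
open import Relation.Binary.PropositionalEquality
  using (_≢_; _≗_; refl; sym; trans; cong; cong₂; subst; subst₂; module ≡-Reasoning)
open import Relation.Nullary using (yes; no; contradiction)
open import Relation.Nullary.Decidable using (True; toWitness; _→-dec_)
open import Relation.Unary using (Pred; Decidable)

open Inverse using (to; from; strictlyInverseˡ)

==-refl : ∀ {N} (x : Fin N) → (x == x) ≡ true
==-refl x with x ≟ᶠ x
... | yes _   = refl
... | no x≢x = contradiction refl x≢x

==-≢ : ∀ {N} {x y : Fin N} → x ≢ y → (x == y) ≡ false
==-≢ {x = x} {y} x≢y with x ≟ᶠ y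
... | yes x≡y = contradiction x≡y x≢y
... | no _    = refl

==-injective : ∀ {N M} (f : Fin N → Fin M) → (∀ {x y} → f x ≡ f y → x ≡ y) →
               ∀ x y → (f x == f y) ≡ (x == y)
==-injective f f-injective x y with x ≟ᶠ y
... | yes refl = ==-refl (f x)
... | no x≢y   = ==-≢ (x≢y ∘ f-injective)

==-↔ : ∀ {N M} (φ : Fin N ↔ Fin M) (x y : Fin N) → (to φ x == to φ y) ≡ (x == y)
==-↔ φ = ==-injective (to φ) (Injection.injective (↔⇒↣ φ))

==-combine : ∀ {a b} (x x' : Fin a) (w w' : Fin b) →
             (combine x w == combine x' w') ≡ ((x == x') ∧ (w == w'))
==-combine x x' w w' with x ≟ᶠ x' | w ≟ᶠ w'
... | yes refl | yes refl = ==-refl (combine x w)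
... | yes refl | no w≢w'  = ==-≢ (w≢w' ∘ proj₂ ∘ combine-injective x w x w')
... | no x≢x'  | _        = ==-≢ (x≢x' ∘ proj₁ ∘ combine-injective x w x' w')

-- Counting

𝟙 : Bool → ℕ
𝟙 b = if b then 1 else 0

count≡sum : ∀ {N} (p : Fin N → Bool) → count p ≡ sum (𝟙 ∘ p)
count≡sum {zero} p = refl
count≡sum {1+ N} p = cong (𝟙 (p zero) +_) (count≡sum (p ∘ suc))

count-cong : ∀ {N} {p q : Fin N → Bool} → p ≗ q → count p ≡ count q
count-cong {zero} p≗q = refl
count-cong {1+ N} p≗q = cong₂ _+_ (cong 𝟙 (p≗q zero)) (count-cong (p≗q ∘ suc))

count-false : ∀ N → count {N} (λ _ → false) ≡ 0
count-false zero   = refl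
count-false (1+ N) = count-false N

count-suc : ∀ {N} (p : Fin N → Bool) {v} → p v ≡ true → ∃ λ k → count p ≡ 1+ k
count-suc p {zero} pv rewrite pv = count (p ∘ suc) , refl
count-suc p {suc v} pv with count-suc (p ∘ suc) pv
... | k , eq = 𝟙 (p zero) + k , trans (cong (𝟙 (p zero) +_) eq) (+-suc (𝟙 (p zero)) k)

count-↔ : ∀ {M N} (φ : Fin M ↔ Fin N) (p : Fin N → Bool) → count (p ∘ to φ) ≡ count p
count-↔ φ p = begin
  count (p ∘ to φ)     ≡⟨ count≡sum (p ∘ to φ) ⟩
  sum (𝟙 ∘ p ∘ to φ)   ≡⟨ sum-permute (𝟙 ∘ p) φ ⟨
  sum (𝟙 ∘ p)          ≡⟨ count≡sum p ⟨
  count p              ∎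
  where open ≡-Reasoning

count-↑ : ∀ b c (p : Fin (b + c) → Bool) → count p ≡ count (p ∘ (_↑ˡ c)) + count (p ∘ (b ↑ʳ_))
count-↑ zero   c p = refl
count-↑ (1+ b) c p = trans (cong (𝟙 (p zero) +_) (count-↑ b c (p ∘ suc))) (sym (+-assoc (𝟙 (p zero)) _ _))

count-combine : ∀ a b (p : Fin (a * b) → Bool) → count p ≡ sum (λ x → count (p ∘ combine {a} {b} x))
count-combine zero   b p = refl
count-combine (1+ a) b p =
  trans (count-↑ b (a * b) p) (cong (count (p ∘ (_↑ˡ (a * b))) +_) (count-combine a b (p ∘ (b ↑ʳ_))))

sum-supported-at : ∀ {n} (f : Fin n → ℕ) (u : Fin n) → (∀ y → y ≢ u → f y ≡ 0) → sum f ≡ f u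
sum-supported-at {1+ n} f u off = begin
  sum f                          ≡⟨ sum-remove {i = u} f ⟩
  f u + sum (f ∘ punchIn u)      ≡⟨ cong (f u +_) (sum-cong-≗ (λ y → off (punchIn u y) (punchInᵢ≢i u y))) ⟩
  f u + sum {n} (λ _ → 0)        ≡⟨ cong (f u +_) (sum-replicate-zero n) ⟩
  f u + 0                        ≡⟨ +-identityʳ (f u) ⟩
  f u                            ∎
  where open ≡-Reasoning

count-singleton : ∀ {N} (q : Fin N → Bool) (x : Fin N) → count (λ z → q z ∧ (x == z)) ≡ 𝟙 (q x)
count-singleton q x = begin
  count (λ z → q z ∧ (x == z))        ≡⟨ count≡sum (λ z → q z ∧ (x == z)) ⟩
  sum (λ z → 𝟙 (q z ∧ (x == z)))      ≡⟨ sum-supported-at _ x off ⟩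
  𝟙 (q x ∧ (x == x))                  ≡⟨ cong (λ b → 𝟙 (q x ∧ b)) (==-refl x) ⟩
  𝟙 (q x ∧ true)                      ≡⟨ cong 𝟙 (∧-identityʳ (q x)) ⟩
  𝟙 (q x)                             ∎
  where
  open ≡-Reasoning
  off : ∀ z → z ≢ x → 𝟙 (q z ∧ (x == z)) ≡ 0
  off z z≢x = cong 𝟙 (trans (cong (q z ∧_) (==-≢ (z≢x ∘ sym))) (∧-zeroʳ (q z)))

count-row : ∀ {a b} (u : Fin a) (R : Fin a × Fin b → Bool) →
            (∀ y z → y ≢ u → R (y , z) ≡ false) → count (R ∘ remQuot {a} b) ≡ count (λ z → R (u , z))
count-row {a} {b} u R off = begin
  count (R ∘ remQuot {a} b)
    ≡⟨ count-combine a b _ ⟩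
  sum (λ y → count (λ z → R (remQuot {a} b (combine {a} {b} y z))))
    ≡⟨ sum-cong-≗ (λ y → count-cong (cong R ∘ remQuot-combine y)) ⟩
  sum (λ y → count (λ z → R (y , z)))
    ≡⟨ sum-supported-at _ u row-off ⟩
  count (λ z → R (u , z)) ∎
  where
  open ≡-Reasoning
  row-off : ∀ y → y ≢ u → count (λ z → R (y , z)) ≡ 0
  row-off y y≢u = trans (count-cong (λ z → off y z y≢u)) (count-false b)

-- Isomorphisms

-- _≅_ with both graphs as record parameters, so that they can be inferred
-- from the type of an isomorphism (the Σ-type of _≅_ hides its target).
record _≃_ {N M} (G : Graph N) (H : Graph M) : Set where
  constructor mk≃
  field
    bijection : Fin N ↔ Fin M
    preserves : ∀ x y → H (to bijection x) (to bijection y) ≡ G x y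
open _≃_

≃⇒≅ : ∀ {N M} {G : Graph N} {H : Graph M} → G ≃ H → G ≅ H
≃⇒≅ (mk≃ φ p) = φ , p

≃-reflexive : ∀ {N} {G H : Graph N} → (∀ x y → G x y ≡ H x y) → G ≃ H
≃-reflexive G≗H = mk≃ ↔-refl λ x y → sym (G≗H x y)

≃-refl : ∀ {N} {G : Graph N} → G ≃ G
≃-refl = ≃-reflexive λ _ _ → refl

≃-sym : ∀ {N M} {G : Graph N} {H : Graph M} → G ≃ H → H ≃ G
≃-sym {G = G} {H} (mk≃ φ p) = mk≃ (↔-sym φ) λ x y →
  trans (sym (p (from φ x) (from φ y))) (cong₂ H (strictlyInverseˡ φ x) (strictlyInverseˡ φ y))

≃-trans : ∀ {N M L} {G : Graph N} {H : Graph M} {K : Graph L} → G ≃ H → H ≃ K → G ≃ K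
≃-trans (mk≃ φ p) (mk≃ ψ q) = mk≃ (↔-trans φ ψ) λ x y → trans (q _ _) (p x y)

module ≃-Reasoning where
  infix  1 begin_
  infixr 2 _≃⟨_⟩_ _≃⟨_⟨_
  infix  3 _∎

  begin_ : ∀ {N M} {G : Graph N} {H : Graph M} → G ≃ H → G ≃ H
  begin G≃H = G≃H

  _≃⟨_⟩_ : ∀ {N M L} (G : Graph N) {H : Graph M} {K : Graph L} → G ≃ H → H ≃ K → G ≃ K
  G ≃⟨ G≃H ⟩ H≃K = ≃-trans G≃H H≃K

  _≃⟨_⟨_ : ∀ {N M L} (G : Graph N) {H : Graph M} {K : Graph L} → H ≃ G → H ≃ K → G ≃ K
  G ≃⟨ H≃G ⟨ H≃K = ≃-trans (≃-sym H≃G) H≃K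

  _∎ : ∀ {N} (G : Graph N) → G ≃ G
  G ∎ = ≃-refl

castGraph : ∀ {M N} → M ≡ N → Graph N → Graph M
castGraph eq G x y = G (cast eq x) (cast eq y)

castGraph-≃ : ∀ {M N} (eq : M ≡ N) (G : Graph N) → castGraph eq G ≃ G
castGraph-≃ eq G = mk≃ (mk↔ₛ′ (cast eq) (cast (sym eq)) (cast-involutive eq (sym eq)) (cast-involutive (sym eq) eq))
                       λ _ _ → refl

-- Cartesian products

data CombineView {a b} : Fin (a * b) → Set where
  combined : (x : Fin a) (w : Fin b) → CombineView (combine x w)

combineView : ∀ {a} b (v : Fin (a * b)) → CombineView {a} {b} v
combineView {a} b v = subst (CombineView {a} {b}) (combine-remQuot {a} b v) (combined _ _)

_⊠_ : ∀ {a b} → Graph a → Graph b → Fin a × Fin b → Fin a × Fin b → Bool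
(A ⊠ B) (x , w) (x' , w') = (A x x' ∧ (w == w')) ∨ ((x == x') ∧ B w w')

□-uncurry-combine : ∀ {a b} (A : Graph a) (B : Graph b) (r s : Fin a × Fin b) →
                    (A □ B) (uncurry combine r) (uncurry combine s) ≡ (A ⊠ B) r s
□-uncurry-combine A B r s = cong₂ (A ⊠ B) (strictlyInverseˡ *↔× r) (strictlyInverseˡ *↔× s)

□-≃ : ∀ {a b M} (A : Graph a) (B : Graph b) (H : Graph M) (ψ : (Fin a × Fin b) ↔ Fin M) →
      (∀ r s → H (to ψ r) (to ψ s) ≡ (A ⊠ B) r s) → (A □ B) ≃ H
□-≃ {a} {b} A B H ψ pres = mk≃ (↔-trans *↔× ψ) λ u v → pres (remQuot {a} b u) (remQuot {a} b v)

□-≃-□ : ∀ {a b c d} (A : Graph a) (B : Graph b) (C : Graph c) (D : Graph d)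
        (ψ : (Fin a × Fin b) ↔ (Fin c × Fin d)) →
        (∀ r s → (C ⊠ D) (to ψ r) (to ψ s) ≡ (A ⊠ B) r s) → (A □ B) ≃ (C □ D)
□-≃-□ A B C D ψ pres =
  □-≃ A B (C □ D) (↔-trans ψ (↔-sym *↔×)) λ r s → trans (□-uncurry-combine C D (to ψ r) (to ψ s)) (pres r s)

□-cong : ∀ {a a' b b'} {A : Graph a} {A' : Graph a'} {B : Graph b} {B' : Graph b'} →
         A ≃ A' → B ≃ B' → (A □ B) ≃ (A' □ B')
□-cong {A = A} {A'} {B} {B'} (mk≃ φ p) (mk≃ ψ q) = □-≃-□ A B A' B' (φ ×-↔ ψ) λ { (x , w) (x' , w') →
  cong₂ _∨_ (cong₂ _∧_ (p x x') (==-↔ ψ w w')) (cong₂ _∧_ (==-↔ φ x x') (q w w')) }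

□-congˡ : ∀ {a b b'} (A : Graph a) {B : Graph b} {B' : Graph b'} → B ≃ B' → (A □ B) ≃ (A □ B')
□-congˡ A = □-cong (≃-refl {G = A})

□-congʳ : ∀ {a a' b} {A : Graph a} {A' : Graph a'} (B : Graph b) → A ≃ A' → (A □ B) ≃ (A' □ B)
□-congʳ B A≃A' = □-cong A≃A' (≃-refl {G = B})

□-comm : ∀ {a b} (A : Graph a) (B : Graph b) → (A □ B) ≃ (B □ A)
□-comm A B = □-≃-□ A B B A (×-comm _ _) λ { (x , w) (x' , w') →
  trans (∨-comm (B w w' ∧ (x == x')) ((w == w') ∧ A x x')) (cong₂ _∨_ (∧-comm (w == w') (A x x')) (∧-comm (B w w') (x == x'))) }

□-assoc : ∀ {a b c} (A : Graph a) (B : Graph b) (C : Graph c) → ((A □ B) □ C) ≃ (A □ (B □ C))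
□-assoc {a} {b} {c} A B C = □-≃-□ (A □ B) C A (B □ C) reassociate pres
  where
  reassociate : (Fin (a * b) × Fin c) ↔ (Fin a × Fin (b * c))
  reassociate = ↔-trans (*↔× ×-↔ ↔-refl) (↔-trans (×-assoc _ _ _ _) (↔-refl ×-↔ ↔-sym *↔×))

  open import Algebra.Solver.Ring.NaturalCoefficients.Default ∨-∧-commutativeSemiring

  reassociate-combine : ∀ x y z → to reassociate (combine x y , z) ≡ (x , combine y z)
  reassociate-combine x y z = cong (λ r → proj₁ r , combine (proj₂ r) z) (remQuot-combine {a} {b} x y)

  pres : ∀ r s → (A ⊠ (B □ C)) (to reassociate r) (to reassociate s) ≡ ((A □ B) ⊠ C) r s
  pres (xy , z) (xy' , z') with combineView {a} b xy | combineView {a} b xy'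
  ... | combined x y | combined x' y' = begin
    (A ⊠ (B □ C)) (to reassociate (combine x y , z)) (to reassociate (combine x' y' , z'))
      ≡⟨ cong₂ (A ⊠ (B □ C)) (reassociate-combine x y z) (reassociate-combine x' y' z') ⟩
    (A x x' ∧ (combine y z == combine y' z')) ∨ ((x == x') ∧ (B □ C) (combine y z) (combine y' z'))
      ≡⟨ cong₂ (λ e adj → (A x x' ∧ e) ∨ ((x == x') ∧ adj))
               (==-combine y y' z z') (□-uncurry-combine B C (y , z) (y' , z')) ⟩
    (A x x' ∧ ((y == y') ∧ (z == z'))) ∨ ((x == x') ∧ ((B y y' ∧ (z == z')) ∨ ((y == y') ∧ C z z')))
      ≡⟨ solve 6 (λ A B C e₁ e₂ e₃ → (A :* (e₂ :* e₃)) :+ (e₁ :* ((B :* e₃) :+ (e₂ :* C)))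
                                  := (((A :* e₂) :+ (e₁ :* B)) :* e₃) :+ ((e₁ :* e₂) :* C))
               refl (A x x') (B y y') (C z z') (x == x') (y == y') (z == z') ⟩
    (((A x x' ∧ (y == y')) ∨ ((x == x') ∧ B y y')) ∧ (z == z')) ∨ (((x == x') ∧ (y == y')) ∧ C z z')
      ≡⟨ cong₂ (λ adj e → (adj ∧ (z == z')) ∨ (e ∧ C z z'))
               (□-uncurry-combine A B (x , y) (x' , y')) (==-combine x x' y y') ⟨
    ((A □ B) ⊠ C) (combine x y , z) (combine x' y' , z') ∎
    where open ≡-Reasoning

□-identityˡ : ∀ {b} (B : Graph b) → (K 1 □ B) ≃ B
□-identityˡ {b} B = □-≃ (K 1) B B Fin1×↔ λ { (zero , w) (zero , w') → refl }
  where
  Fin1×↔ : (Fin 1 × Fin b) ↔ Fin b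
  Fin1×↔ = mk↔ₛ′ proj₂ (zero ,_) (λ _ → refl) λ { (zero , w) → refl }

Loopless : ∀ {N} → Graph N → Set
Loopless G = ∀ x → G x x ≡ false

□-loopless : ∀ {a b} (A : Graph a) (B : Graph b) → Loopless A → Loopless B → Loopless (A □ B)
□-loopless {a} {b} A B A-loopless B-loopless v = ⊠-loopless (remQuot {a} b v)
  where
  ⊠-loopless : ∀ r → (A ⊠ B) r r ≡ false
  ⊠-loopless (x , w) rewrite A-loopless x | B-loopless w | ==-refl x = refl

K-loopless : ∀ q → Loopless (K q)
K-loopless q x = cong not (==-refl x)

Hamming4-loopless : ∀ d → Loopless (Hamming4 d)
Hamming4-loopless zero   = K-loopless 1
Hamming4-loopless (1+ d) = □-loopless (K 4) (Hamming4 d) (K-loopless 4) (Hamming4-loopless d)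

Fin-^ : ∀ {q} → Fin q → ∀ d → Fin (q ^ d)
Fin-^ x zero   = zero
Fin-^ x (1+ d) = combine x (Fin-^ x d)

-- Godsil–McKay switching

record SwitchesTo {N M} (G : Graph N) (G' : Graph M) : Set where
  constructor switching
  field
    {cells}     : ℕ
    partition   : Partition N cells
    godsilMcKay : IsGodsilMcKay G partition
    switched    : G' ≃ sw partition G

SwitchesTo⇒Σ : ∀ {N M} {G : Graph N} {G' : Graph M} → SwitchesTo G G' →
               Σ ℕ λ t → Σ (Partition N t) λ π → IsGodsilMcKay G π × (G' ≅ sw π G)
SwitchesTo⇒Σ (switching π gm G'≃) = _ , π , gm , ≃⇒≅ G'≃

SwitchesTo-respʳ : ∀ {N M L} {G : Graph N} {G' : Graph M} {G'' : Graph L} →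
                   SwitchesTo G G' → G'' ≃ G' → SwitchesTo G G''
SwitchesTo-respʳ (switching π gm G'≃) G''≃G' = switching π gm (≃-trans G''≃G' G'≃)

NoneHalfOrAll : ℕ → ℕ → Set
NoneHalfOrAll k size = (k ≡ 0) ⊎ (2 * k ≡ size) ⊎ (k ≡ size)

module _ {N t} (π : Partition N t) where

  inCell-just : ∀ {i j v} → label π v ≡ just j → inCell π i v ≡ (j == i)
  inCell-just eq rewrite eq = refl

  inCell-nothing : ∀ {i v} → label π v ≡ nothing → inCell π i v ≡ false
  inCell-nothing eq rewrite eq = refl

  cellSize-suc : ∀ i → ∃ λ k → cellSize π i ≡ 1+ k
  cellSize-suc i = let v , v∈C = C-nonempty π i in count-suc (inCell π i) (trans (inCell-just v∈C) (==-refl i))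

  module _ (G : Graph N) where

    flips-D→C : ∀ {x y i} → label π x ≡ nothing → label π y ≡ just i →
                flips G π x y ≡ (2 * nbrsIn G π x i ≡ᵇ cellSize π i)
    flips-D→C x∈D y∈C rewrite x∈D | y∈C = refl

    flips-from-C : ∀ {x y j} → label π x ≡ just j → flips G π x y ≡ false
    flips-from-C x∈C rewrite x∈C = refl

    flips-to-D : ∀ {x y} → label π y ≡ nothing → flips G π x y ≡ false
    flips-to-D {x} y∈D with label π x
    ... | just _  = refl
    ... | nothing rewrite y∈D = refl

module _ {N M t} {G₁ : Graph N} {G : Graph M} (φ : G₁ ≃ G) (π : Partition M t) where
  private
    f : Fin N → Fin M
    f = to (bijection φ)

    pull : ∀ {m} → ∃ (λ v → label π v ≡ m) → ∃ (λ v → label π (f v) ≡ m)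
    pull (v , eq) = from (bijection φ) v , trans (cong (label π) (strictlyInverseˡ (bijection φ) v)) eq

  pullback : Partition N t
  pullback = record
    { label      = label π ∘ f
    ; C-nonempty = pull ∘ C-nonempty π
    ; D-nonempty = pull (D-nonempty π)
    }

  inCell-pullback : ∀ i v → inCell pullback i v ≡ inCell π i (f v)
  inCell-pullback i v with label π (f v)
  ... | just _  = refl
  ... | nothing = refl

  nbrsIn-pullback : ∀ x i → nbrsIn G₁ pullback x i ≡ nbrsIn G π (f x) i
  nbrsIn-pullback x i = trans (count-cong λ v → cong₂ _∧_ (inCell-pullback i v) (sym (preserves φ x v)))
                              (count-↔ (bijection φ) (λ w → inCell π i w ∧ G (f x) w))

  cellSize-pullback : ∀ i → cellSize pullback i ≡ cellSize π i
  cellSize-pullback i = trans (count-cong (inCell-pullback i)) (count-↔ (bijection φ) (inCell π i))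

  flips-pullback : ∀ x y → flips G₁ pullback x y ≡ flips G π (f x) (f y)
  flips-pullback x y with label π (f x) | label π (f y)
  ... | nothing | just i  = cong₂ (λ k size → 2 * k ≡ᵇ size) (nbrsIn-pullback x i) (cellSize-pullback i)
  ... | nothing | nothing = refl
  ... | just _  | _       = refl

  sw-pullback : sw pullback G₁ ≃ sw π G
  sw-pullback = mk≃ (bijection φ) λ x y → sym (sw-at x y)
    where
    sw-at : ∀ x y → sw pullback G₁ x y ≡ sw π G (f x) (f y)
    sw-at x y rewrite flips-pullback x y | flips-pullback y x | preserves φ x y = refl

  isGodsilMcKay-pullback : IsGodsilMcKay G π → IsGodsilMcKay G₁ pullback
  isGodsilMcKay-pullback gm = record
    { equitable   = λ i j u v u∈Cᵢ v∈Cᵢ →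
        trans (nbrsIn-pullback u j) (trans (equitable gm i j (f u) (f v) u∈Cᵢ v∈Cᵢ) (sym (nbrsIn-pullback v j)))
    ; D-condition = λ x x∈D i →
        subst₂ NoneHalfOrAll (sym (nbrsIn-pullback x i)) (sym (cellSize-pullback i)) (D-condition gm (f x) x∈D i)
    }
    where open IsGodsilMcKay

SwitchesTo-respˡ : ∀ {N M L} {G₁ : Graph N} {G : Graph M} {G' : Graph L} →
                   G₁ ≃ G → SwitchesTo G G' → SwitchesTo G₁ G'
SwitchesTo-respˡ φ (switching π gm G'≃) =
  switching (pullback φ π) (isGodsilMcKay-pullback φ π gm) (≃-trans G'≃ (≃-sym (sw-pullback φ π)))

module _ {p N t} (P : Graph p) (P-loopless : Loopless P) (u₀ : Fin p) (G : Graph N) (π : Partition N t) where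
  private
    coords : Fin (p * N) → Fin p × Fin N
    coords = remQuot {p} N

    row : Fin (p * N) → Fin p
    row = proj₁ ∘ coords

    col : Fin (p * N) → Fin N
    col = proj₂ ∘ coords

  liftedLabel : Fin (p * N) → Maybe (Fin (p * t))
  liftedLabel v = map (combine (row v)) (label π (col v))

  liftedLabel-combine : ∀ {u : Fin p} {x m} → label π x ≡ m → liftedLabel (combine u x) ≡ map (combine u) m
  liftedLabel-combine {u} {x} refl = cong (λ r → map (combine (proj₁ r)) (label π (proj₂ r))) (remQuot-combine u x)

  private
    lift-witness : ∀ (u : Fin p) {m} → ∃ (λ x → label π x ≡ m) → ∃ (λ v → liftedLabel v ≡ map (combine u) m)
    lift-witness u (x , eq) = combine u x , liftedLabel-combine eq

    lifted-C-nonempty : ∀ c → ∃ λ v → liftedLabel v ≡ just c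
    lifted-C-nonempty c with combineView {p} t c
    ... | combined u i = lift-witness u (C-nonempty π i)

  lifted : Partition (p * N) (p * t)
  lifted = record
    { label      = liftedLabel
    ; C-nonempty = lifted-C-nonempty
    ; D-nonempty = lift-witness u₀ (D-nonempty π)
    }

  private
    map-combine-just : ∀ {u w : Fin p} {i : Fin t} (m : Maybe (Fin t)) → map (combine u) m ≡ just (combine w i) → u ≡ w × m ≡ just i
    map-combine-just {u} {w} {i} (just j) eq with combine-injective u j w i (just-injective eq)
    ... | refl , refl = refl , refl
    map-combine-just nothing ()

    map-combine-nothing : ∀ {u : Fin p} (m : Maybe (Fin t)) → map (combine u) m ≡ nothing → m ≡ nothing
    map-combine-nothing nothing  _  = refl
    map-combine-nothing (just _) ()

  liftedLabel-just : ∀ {u w : Fin p} {x i} → liftedLabel (combine u x) ≡ just (combine w i) → u ≡ w × label π x ≡ just i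
  liftedLabel-just {u} {x = x} eq = map-combine-just (label π x) (trans (sym (liftedLabel-combine {u} {x} refl)) eq)

  liftedLabel-nothing : ∀ {u : Fin p} {x} → liftedLabel (combine u x) ≡ nothing → label π x ≡ nothing
  liftedLabel-nothing {u} {x} eq = map-combine-nothing (label π x) (trans (sym (liftedLabel-combine {u} {x} refl)) eq)

  inCell-lifted : ∀ u i v → inCell lifted (combine u i) v ≡ ((row v == u) ∧ inCell π i (col v))
  inCell-lifted u i v with label π (col v)
  ... | just j  = ==-combine (row v) u j i
  ... | nothing = sym (∧-zeroʳ (row v == u))

  cellSize-lifted : ∀ u i → cellSize lifted (combine u i) ≡ cellSize π i
  cellSize-lifted u i = begin
    count (inCell lifted (combine u i))                ≡⟨ count-cong (inCell-lifted u i) ⟩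
    count (λ v → (row v == u) ∧ inCell π i (col v))    ≡⟨ count-row u _ (λ y z y≢u → cong (_∧ inCell π i z) (==-≢ y≢u)) ⟩
    count (λ z → (u == u) ∧ inCell π i z)              ≡⟨ count-cong (λ z → cong (_∧ inCell π i z) (==-refl u)) ⟩
    count (inCell π i)                                 ∎
    where open ≡-Reasoning

  nbrsIn-lifted : ∀ u x u' i → nbrsIn (P □ G) lifted (combine u x) (combine u' i) ≡
                               count (λ z → inCell π i z ∧ (P ⊠ G) (u , x) (u' , z))
  nbrsIn-lifted u x u' i = begin
    count (λ v → inCell lifted (combine u' i) v ∧ (P □ G) (combine u x) v)
      ≡⟨ count-cong (λ v → cong₂ _∧_ (inCell-lifted u' i v)
                                     (cong (λ r → (P ⊠ G) r (coords v)) (remQuot-combine u x))) ⟩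
    count (R ∘ coords)
      ≡⟨ count-row u' R (λ y z y≢u' → cong (λ b → (b ∧ inCell π i z) ∧ (P ⊠ G) (u , x) (y , z)) (==-≢ y≢u')) ⟩
    count (λ z → R (u' , z))
      ≡⟨ count-cong (λ z → cong (λ b → (b ∧ inCell π i z) ∧ (P ⊠ G) (u , x) (u' , z)) (==-refl u')) ⟩
    count (λ z → inCell π i z ∧ (P ⊠ G) (u , x) (u' , z)) ∎
    where
    open ≡-Reasoning
    R : Fin p × Fin N → Bool
    R (y , z) = ((y == u') ∧ inCell π i z) ∧ (P ⊠ G) (u , x) (y , z)

  nbrsIn-lifted-same-row : ∀ u x i → nbrsIn (P □ G) lifted (combine u x) (combine u i) ≡ nbrsIn G π x i
  nbrsIn-lifted-same-row u x i = trans (nbrsIn-lifted u x u i) (count-cong λ z →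
    cong₂ (λ a b → inCell π i z ∧ ((a ∧ (x == z)) ∨ (b ∧ G x z))) (P-loopless u) (==-refl u))

  -- Across rows only the P-edge uv to the copy of x itself contributes.
  nbrsIn-lifted-other-row : ∀ {u u'} x i → u ≢ u' →
                            nbrsIn (P □ G) lifted (combine u x) (combine u' i) ≡ 𝟙 (P u u' ∧ inCell π i x)
  nbrsIn-lifted-other-row {u} {u'} x i u≢u' = begin
    nbrsIn (P □ G) lifted (combine u x) (combine u' i)
      ≡⟨ nbrsIn-lifted u x u' i ⟩
    count (λ z → inCell π i z ∧ ((P u u' ∧ (x == z)) ∨ ((u == u') ∧ G x z)))
      ≡⟨ count-cong (λ z → cong (λ b → inCell π i z ∧ ((P u u' ∧ (x == z)) ∨ (b ∧ G x z))) (==-≢ u≢u')) ⟩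
    count (λ z → inCell π i z ∧ ((P u u' ∧ (x == z)) ∨ false))
      ≡⟨ count-cong (λ z → trans (cong (inCell π i z ∧_) (∨-identityʳ _)) (reorder (inCell π i z) (P u u') (x == z))) ⟩
    count (λ z → (P u u' ∧ inCell π i z) ∧ (x == z))
      ≡⟨ count-singleton (λ z → P u u' ∧ inCell π i z) x ⟩
    𝟙 (P u u' ∧ inCell π i x) ∎
    where
    open ≡-Reasoning
    reorder : ∀ a b c → (a ∧ (b ∧ c)) ≡ ((b ∧ a) ∧ c)
    reorder a b c = trans (sym (∧-assoc a b c)) (cong (_∧ c) (∧-comm a b))

  module _ (gm : IsGodsilMcKay G π) where
    open IsGodsilMcKay gm

    private
      equitable-lifted-row : ∀ {u x₁ x₂ i} → label π x₁ ≡ just i → label π x₂ ≡ just i → ∀ u' j →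
                             nbrsIn (P □ G) lifted (combine u x₁) (combine u' j) ≡
                             nbrsIn (P □ G) lifted (combine u x₂) (combine u' j)
      equitable-lifted-row {u} {x₁} {x₂} {i} x₁∈Cᵢ x₂∈Cᵢ u' j with u ≟ᶠ u'
      ... | yes refl = begin
        nbrsIn (P □ G) lifted (combine u x₁) (combine u j)  ≡⟨ nbrsIn-lifted-same-row u x₁ j ⟩
        nbrsIn G π x₁ j                                     ≡⟨ equitable i j x₁ x₂ x₁∈Cᵢ x₂∈Cᵢ ⟩
        nbrsIn G π x₂ j                                     ≡⟨ nbrsIn-lifted-same-row u x₂ j ⟨
        nbrsIn (P □ G) lifted (combine u x₂) (combine u j)  ∎
        where open ≡-Reasoning
      ... | no u≢u' = begin
        nbrsIn (P □ G) lifted (combine u x₁) (combine u' j)  ≡⟨ nbrsIn-lifted-other-row x₁ j u≢u' ⟩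
        𝟙 (P u u' ∧ inCell π j x₁)                           ≡⟨ cong (λ b → 𝟙 (P u u' ∧ b)) (inCell-just π x₁∈Cᵢ) ⟩
        𝟙 (P u u' ∧ (i == j))                                ≡⟨ cong (λ b → 𝟙 (P u u' ∧ b)) (inCell-just π x₂∈Cᵢ) ⟨
        𝟙 (P u u' ∧ inCell π j x₂)                           ≡⟨ nbrsIn-lifted-other-row x₂ j u≢u' ⟨
        nbrsIn (P □ G) lifted (combine u x₂) (combine u' j)  ∎
        where open ≡-Reasoning

      D-condition-lifted-row : ∀ {u x} → label π x ≡ nothing → ∀ u' i →
                               NoneHalfOrAll (nbrsIn (P □ G) lifted (combine u x) (combine u' i))
                                             (cellSize lifted (combine u' i))
      D-condition-lifted-row {u} {x} x∈D u' i with u ≟ᶠ u'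
      ... | yes refl = subst₂ NoneHalfOrAll (sym (nbrsIn-lifted-same-row u x i)) (sym (cellSize-lifted u i))
                              (D-condition x x∈D i)
      ... | no u≢u'  = inj₁ (trans (nbrsIn-lifted-other-row x i u≢u')
                                   (cong 𝟙 (trans (cong (P u u' ∧_) (inCell-nothing π x∈D)) (∧-zeroʳ (P u u')))))

    isGodsilMcKay-lifted : IsGodsilMcKay (P □ G) lifted
    isGodsilMcKay-lifted = record { equitable = equitable-lifted ; D-condition = D-condition-lifted }
      where
      equitable-lifted : ∀ c j v₁ v₂ → liftedLabel v₁ ≡ just c → liftedLabel v₂ ≡ just c →
                         nbrsIn (P □ G) lifted v₁ j ≡ nbrsIn (P □ G) lifted v₂ j
      equitable-lifted c j v₁ v₂ v₁∈c v₂∈c with combineView {p} t c | combineView {p} t j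
                                              | combineView {p} N v₁ | combineView {p} N v₂
      ... | combined w i | combined u' j′ | combined u₁ x₁ | combined u₂ x₂
        with liftedLabel-just v₁∈c | liftedLabel-just v₂∈c
      ...   | refl , x₁∈Cᵢ | refl , x₂∈Cᵢ = equitable-lifted-row x₁∈Cᵢ x₂∈Cᵢ u' j′

      D-condition-lifted : ∀ v → liftedLabel v ≡ nothing → ∀ c →
                           NoneHalfOrAll (nbrsIn (P □ G) lifted v c) (cellSize lifted c)
      D-condition-lifted v v∈D c with combineView {p} N v | combineView {p} t c
      ... | combined u x | combined u' i = D-condition-lifted-row (liftedLabel-nothing v∈D) u' i

  private
    halfCell-lifted : ∀ {x} → label π x ≡ nothing → ∀ u u' i →
      (2 * nbrsIn (P □ G) lifted (combine u x) (combine u' i) ≡ᵇ cellSize lifted (combine u' i)) ≡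
      ((u == u') ∧ (2 * nbrsIn G π x i ≡ᵇ cellSize π i))
    halfCell-lifted {x} x∈D u u' i with u ≟ᶠ u'
    ... | yes refl = cong₂ (λ k size → 2 * k ≡ᵇ size) (nbrsIn-lifted-same-row u x i) (cellSize-lifted u i)
    ... | no u≢u' rewrite nbrsIn-lifted-other-row x i u≢u' | inCell-nothing π {i} x∈D | ∧-zeroʳ (P u u') | cellSize-lifted u' i | proj₂ (cellSize-suc π i) = refl

  flips-lifted : ∀ u x u' y → flips (P □ G) lifted (combine u x) (combine u' y) ≡ ((u == u') ∧ flips G π x y)
  flips-lifted u x u' y with label π x in x∈ | label π y in y∈
  ... | just _  | _       = trans (flips-from-C lifted (P □ G) (liftedLabel-combine x∈)) (sym (∧-zeroʳ (u == u')))
  ... | nothing | nothing = trans (flips-to-D lifted (P □ G) (liftedLabel-combine y∈)) (sym (∧-zeroʳ (u == u')))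
  ... | nothing | just i  =
    trans (flips-D→C lifted (P □ G) (liftedLabel-combine x∈) (liftedLabel-combine y∈)) (halfCell-lifted x∈ u u' i)

  sw-lifted : (P □ sw π G) ≃ sw lifted (P □ G)
  sw-lifted = ≃-reflexive λ v v′ → sym (sw-at v v′)
    where
    switch : Bool → Bool → Bool
    switch f a = if f then not a else a

    switch-rows : ∀ u x u' y →
      switch (((u == u') ∧ flips G π x y) ∨ ((u' == u) ∧ flips G π y x)) ((P ⊠ G) (u , x) (u' , y)) ≡
      (P ⊠ sw π G) (u , x) (u' , y)
    switch-rows u x u' y with u ≟ᶠ u'
    ... | yes refl rewrite ==-refl u | P-loopless u = refl
    ... | no u≢u'  rewrite ==-≢ (u≢u' ∘ sym) = refl

    sw-at : ∀ v v′ → sw lifted (P □ G) v v′ ≡ (P □ sw π G) v v′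
    sw-at v v′ with combineView {p} N v | combineView {p} N v′
    ... | combined u x | combined u' y = begin
      switch (flips (P □ G) lifted (combine u x) (combine u' y) ∨ flips (P □ G) lifted (combine u' y) (combine u x))
             ((P □ G) (combine u x) (combine u' y))
        ≡⟨ cong₂ switch (cong₂ _∨_ (flips-lifted u x u' y) (flips-lifted u' y u x))
                        (□-uncurry-combine P G (u , x) (u' , y)) ⟩
      switch (((u == u') ∧ flips G π x y) ∨ ((u' == u) ∧ flips G π y x)) ((P ⊠ G) (u , x) (u' , y))
        ≡⟨ switch-rows u x u' y ⟩
      (P ⊠ sw π G) (u , x) (u' , y)
        ≡⟨ □-uncurry-combine P (sw π G) (u , x) (u' , y) ⟨
      (P □ sw π G) (combine u x) (combine u' y) ∎
      where open ≡-Reasoning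

SwitchesTo-□ˡ : ∀ {p N M} (P : Graph p) → Loopless P → Fin p → {G : Graph N} {G' : Graph M} →
                SwitchesTo G G' → SwitchesTo (P □ G) (P □ G')
SwitchesTo-□ˡ P P-loopless u₀ {G} (switching π gm G'≃) =
  switching (lifted P P-loopless u₀ G π) (isGodsilMcKay-lifted P P-loopless u₀ G π gm)
            (≃-trans (□-congˡ P G'≃) (sw-lifted P P-loopless u₀ G π))

SwitchesTo-□ʳ : ∀ {q N M} (Q : Graph q) → Loopless Q → Fin q → {G : Graph N} {G' : Graph M} →
                SwitchesTo G G' → SwitchesTo (G □ Q) (G' □ Q)
SwitchesTo-□ʳ Q Q-loopless w₀ {G} {G'} G⇝G' =
  SwitchesTo-respˡ (□-comm G Q) (SwitchesTo-respʳ (SwitchesTo-□ˡ Q Q-loopless w₀ G⇝G') (□-comm G' Q))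

-- From Hamming to Doob graphs

by-exhaustion : ∀ {n ℓ} {P : Pred (Fin n) ℓ} (P? : Decidable P) → {True (all? P?)} → ∀ v → P v
by-exhaustion P? {all-hold} = toWitness all-hold

Shrikhande-loopless : Loopless Shrikhande
Shrikhande-loopless = by-exhaustion λ v → Shrikhande v v ≟ᵇ false

ShPow-loopless : ∀ j → Loopless (ShPow j)
ShPow-loopless zero   = K-loopless 1
ShPow-loopless (1+ j) = □-loopless Shrikhande (ShPow j) Shrikhande-loopless (ShPow-loopless j)

diagonal-independent : ∀ v → diagLabel v ≡ just zero → nbrsIn (Hamming4 2) diagPartition v zero ≡ 0
diagonal-independent = by-exhaustion λ v →
  ≡-decᵐ _≟ᶠ_ (diagLabel v) (just zero) →-dec (nbrsIn (Hamming4 2) diagPartition v zero ≟ⁿ 0)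

off-diagonal-halves : ∀ v → diagLabel v ≡ nothing →
                      2 * nbrsIn (Hamming4 2) diagPartition v zero ≡ cellSize diagPartition zero
off-diagonal-halves = by-exhaustion λ v →
  ≡-decᵐ _≟ᶠ_ (diagLabel v) nothing →-dec (2 * nbrsIn (Hamming4 2) diagPartition v zero ≟ⁿ cellSize diagPartition zero)

Hamming-switches-to-Shrikhande : SwitchesTo (Hamming4 2) Shrikhande
Hamming-switches-to-Shrikhande = switching diagPartition isGodsilMcKay ≃-refl
  where
  isGodsilMcKay : IsGodsilMcKay (Hamming4 2) diagPartition
  isGodsilMcKay = record
    { equitable   = λ { zero zero u v u∈C v∈C → trans (diagonal-independent u u∈C) (sym (diagonal-independent v v∈C)) }
    ; D-condition = λ { x x∈D zero → inj₂ (inj₁ (off-diagonal-halves x x∈D)) }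
    }

K4-K4-switches-to-Shrikhande : ∀ {N} (X : Graph N) → Loopless X → Fin N →
                               SwitchesTo (K 4 □ (K 4 □ X)) (Shrikhande □ X)
K4-K4-switches-to-Shrikhande X X-loopless x₀ =
  SwitchesTo-respˡ regroup (SwitchesTo-□ʳ X X-loopless x₀ Hamming-switches-to-Shrikhande)
  where
  open ≃-Reasoning
  regroup : (K 4 □ (K 4 □ X)) ≃ (Hamming4 2 □ X)
  regroup = begin
    K 4 □ (K 4 □ X)          ≃⟨ □-congˡ (K 4) (□-congˡ (K 4) (□-identityˡ X)) ⟨
    K 4 □ (K 4 □ (K 1 □ X))  ≃⟨ □-congˡ (K 4) (□-assoc (K 4) (K 1) X) ⟨
    K 4 □ ((K 4 □ K 1) □ X)  ≃⟨ □-assoc (K 4) (K 4 □ K 1) X ⟨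
    (K 4 □ (K 4 □ K 1)) □ X  ∎

Doob-switch : ∀ j d → SwitchesTo (Doob j (2 + d)) (Doob (1+ j) d)
Doob-switch j d = SwitchesTo-respʳ (SwitchesTo-□ˡ (ShPow j) (ShPow-loopless j) (Fin-^ zero j)
                                     (K4-K4-switches-to-Shrikhande (Hamming4 d) (Hamming4-loopless d) (Fin-^ zero d)))
                                   regroup
  where
  open ≃-Reasoning
  regroup : Doob (1+ j) d ≃ (ShPow j □ (Shrikhande □ Hamming4 d))
  regroup = begin
    (Shrikhande □ ShPow j) □ Hamming4 d  ≃⟨ □-congʳ (Hamming4 d) (□-comm Shrikhande (ShPow j)) ⟩
    (ShPow j □ Shrikhande) □ Hamming4 d  ≃⟨ □-assoc (ShPow j) Shrikhande (Hamming4 d) ⟩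
    ShPow j □ (Shrikhande □ Hamming4 d)  ∎

Doob-cong : ∀ {j j' d d'} → j ≡ j' → d ≡ d' → Doob j d ≃ Doob j' d'
Doob-cong refl refl = ≃-refl

module _ (m n : ℕ) where

  vertexCount : ∀ j → j ≤ m → 4 ^ (2 * m + n) ≡ 16 ^ j * 4 ^ (2 * (m ∸ j) + n)
  vertexCount j j≤m = begin
    4 ^ (2 * m + n)                         ≡⟨ cong (λ e → 4 ^ (e + n)) 2m≡2j+2[m∸j] ⟩
    4 ^ ((2 * j + 2 * (m ∸ j)) + n)         ≡⟨ cong (4 ^_) (+-assoc (2 * j) (2 * (m ∸ j)) n) ⟩
    4 ^ (2 * j + (2 * (m ∸ j) + n))         ≡⟨ ^-distribˡ-+-* 4 (2 * j) _ ⟩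
    4 ^ (2 * j) * 4 ^ (2 * (m ∸ j) + n)     ≡⟨ cong (_* 4 ^ (2 * (m ∸ j) + n)) (^-*-assoc 4 2 j) ⟨
    16 ^ j * 4 ^ (2 * (m ∸ j) + n)          ∎
    where
    open ≡-Reasoning
    2m≡2j+2[m∸j] : 2 * m ≡ 2 * j + 2 * (m ∸ j)
    2m≡2j+2[m∸j] = trans (cong (2 *_) (sym (m+[n∸m]≡n j≤m))) (*-distribˡ-+ 2 j (m ∸ j))

  vertexCount-Γ : (k : Fin (1+ m)) → 4 ^ (2 * m + n) ≡ 16 ^ toℕ k * 4 ^ (2 * (m ∸ toℕ k) + n)
  vertexCount-Γ k = vertexCount (toℕ k) (≤-pred (toℕ<n k))

  -- Γ k is D(k, 2(m − k) + n) on the common vertex set; Γ zero must be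
  -- H(2m + n, 4) itself rather than the isomorphic K₁ □ H(2m + n, 4).
  Γ : Fin (1+ m) → Graph (4 ^ (2 * m + n))
  Γ zero        = Hamming4 (2 * m + n)
  Γ k@(suc _)   = castGraph (vertexCount-Γ k) (Doob (toℕ k) (2 * (m ∸ toℕ k) + n))

  Γ≃Doob : ∀ k → Γ k ≃ Doob (toℕ k) (2 * (m ∸ toℕ k) + n)
  Γ≃Doob zero        = ≃-sym (□-identityˡ (Hamming4 (2 * m + n)))
  Γ≃Doob k@(suc _)   = castGraph-≃ (vertexCount-Γ k) (Doob (toℕ k) (2 * (m ∸ toℕ k) + n))

  Γ-switch : ∀ k → SwitchesTo (Γ (inject₁ k)) (Γ (suc k))
  Γ-switch k = SwitchesTo-respˡ (≃-trans (Γ≃Doob (inject₁ k)) (Doob-cong (toℕ-inject₁ k) dimension))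
                                (SwitchesTo-respʳ (Doob-switch (toℕ k) (2 * (m ∸ 1+ (toℕ k)) + n)) (Γ≃Doob (suc k)))
    where
    open ≡-Reasoning
    dimension : 2 * (m ∸ toℕ (inject₁ k)) + n ≡ 2 + (2 * (m ∸ 1+ (toℕ k)) + n)
    dimension = begin
      2 * (m ∸ toℕ (inject₁ k)) + n      ≡⟨ cong (λ e → 2 * (m ∸ e) + n) (toℕ-inject₁ k) ⟩
      2 * (m ∸ toℕ k) + n                ≡⟨ cong (λ e → 2 * e + n) (+-∸-assoc 1 (toℕ<n k)) ⟩
      2 * 1+ (m ∸ 1+ (toℕ k)) + n        ≡⟨ cong (_+ n) (*-suc 2 (m ∸ 1+ (toℕ k))) ⟩
      2 + (2 * (m ∸ 1+ (toℕ k)) + n)     ∎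

  Γ-last≃Doob : Γ (fromℕ m) ≃ Doob m n
  Γ-last≃Doob = ≃-trans (Γ≃Doob (fromℕ m)) (Doob-cong (toℕ-fromℕ m) (cong (λ e → 2 * e + n) m∸m≡0))
    where
    m∸m≡0 : m ∸ toℕ (fromℕ m) ≡ 0
    m∸m≡0 = trans (cong (m ∸_) (toℕ-fromℕ m)) (n∸n≡0 m)

theorem5p1 : (m n : ℕ) → 1 ≤ m →
    Σ (Fin (1+ m) → Graph (4 ^ (2 * m + n))) λ Γ →
      (∀ x y → Γ zero x y ≡ Hamming4 (2 * m + n) x y)
      × (∀ (k : Fin m) → Σ ℕ λ t → Σ (Partition (4 ^ (2 * m + n)) t) λ π →
           IsGodsilMcKay (Γ (inject₁ k)) π × (Γ (suc k) ≅ sw π (Γ (inject₁ k))))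
      × (Γ (fromℕ m) ≅ Doob m n)
theorem5p1 m n _ = Γ m n , (λ _ _ → refl) , SwitchesTo⇒Σ ∘ Γ-switch m n , ≃⇒≅ (Γ-last≃Doob m n)
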